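{- Let $G_1$ be an edge-regular graph with parameters $(n_1,k_1,\lambda_1)$ and $G_2$ an edge-regular graph with parameters $(n_2,k_2,\lambda_2)$. Then the strong product $G_1\boxtimes G_2$ is an edge-regular graph with parameters $(n_1n_2,\,k_1+k_2+k_1k_2,\,\lambda)$ if and only if $$\lambda_2+k_1\lambda_2+2k_1=\lambda_1+k_2\lambda_1+2k_2=\lambda_1\lambda_2+2\lambda_2+2\lambda_1+2=\lambda.$$
   Context: All graphs are finite and simple. A graph on $n$ vertices is edge-regular with parameters $(n,k,\lambda)$ if every vertex has exactly $k$ neighbours and any two adjacent vertices have exactly $\lambda$ common neighbours. The strong product $G_1\boxtimes G_2$ has vertex set $V(G_1)\times V(G_2)$, with distinct vertices $(u,v)$ and $(u',v')$ adjacent precisely when ($u=u'$ or $uu'\in E(G_1)$) and ($v=v'$ or $vv'\in E(G_2)$); equivalently, its edge set is the union of the edge sets of the Cartesian product and the direct product. -}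

module Defs where

open import Data.Nat using (ℕ; zero; suc; _+_; _*_)
open import Data.Bool using (Bool; true; false; _∧_; _∨_; not; if_then_else_)
open import Data.Fin using (Fin; remQuot; _≟_)
open import Data.List using (List; map; allFin)
open import Data.Nat.ListAction using (sum)
open import Data.Product using (_×_; _,_; proj₁; proj₂; ∃; ∃₂)
open import Relation.Nullary.Decidable using (⌊_⌋)
open import Relation.Binary.PropositionalEquality using (_≡_; refl; cong₂)
import Relation.Binary.PropositionalEquality as Eq
open import Relation.Nullary using (yes; no)
open import Data.Empty using (⊥-elim)

record Graph (n : ℕ) : Set where
  field
    adj    : Fin n → Fin n → Bool
    irrefl : ∀ u → adj u u ≡ false
    sym    : ∀ u v → adj u v ≡ adj v u
open Graph public

count : {n : ℕ} → (Fin n → Bool) → ℕ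
count {n} p = sum (map (λ w → if p w then 1 else 0) (allFin n))

degree : {n : ℕ} → Graph n → Fin n → ℕ
degree G u = count (λ w → adj G u w)

commonNeighbours : {n : ℕ} → Graph n → Fin n → Fin n → ℕ
commonNeighbours G u v = count (λ w → adj G u w ∧ adj G v w)

EdgeRegular : {n : ℕ} → Graph n → ℕ → ℕ → Set
EdgeRegular G k lam =
  (∀ u → degree G u ≡ k) ×
  (∀ u v → adj G u v ≡ true → commonNeighbours G u v ≡ lam)

HasEdge : {n : ℕ} → Graph n → Set
HasEdge G = ∃₂ λ u v → adj G u v ≡ true

eqb : {n : ℕ} → Fin n → Fin n → Bool
eqb u v = ⌊ u ≟ v ⌋

-- Strong product. Vertex set Fin n₁ × Fin n₂ is identified with Fin (n₁ * n₂)
-- via the standard bijection remQuot / combine.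
strongAdj : {n₁ n₂ : ℕ} → Graph n₁ → Graph n₂ → Fin (n₁ * n₂) → Fin (n₁ * n₂) → Bool
strongAdj {n₁} {n₂} G₁ G₂ i j =
  let (u  , v ) = remQuot {n₁} n₂ i
      (u' , v') = remQuot {n₁} n₂ j
  in not (eqb i j) ∧ ((eqb u u' ∨ adj G₁ u u') ∧ (eqb v v' ∨ adj G₂ v v'))

eqb-refl : {n : ℕ} (u : Fin n) → eqb u u ≡ true
eqb-refl u with u ≟ u
... | yes _ = refl
... | no ¬p = ⊥-elim (¬p refl)

eqb-sym : {n : ℕ} (u v : Fin n) → eqb u v ≡ eqb v u
eqb-sym u v with u ≟ v | v ≟ u
... | yes _ | yes _ = refl
... | no _  | no _  = refl
... | yes p | no ¬q = ⊥-elim (¬q (Eq.sym p))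
... | no ¬p | yes q = ⊥-elim (¬p (Eq.sym q))

strong-irrefl : {n₁ n₂ : ℕ} (G₁ : Graph n₁) (G₂ : Graph n₂) (i : Fin (n₁ * n₂)) →
                strongAdj G₁ G₂ i i ≡ false
strong-irrefl G₁ G₂ i rewrite eqb-refl i = refl

strongProduct : {n₁ n₂ : ℕ} → Graph n₁ → Graph n₂ → Graph (n₁ * n₂)
strongProduct {n₁} {n₂} G₁ G₂ = record
  { adj    = strongAdj G₁ G₂
  ; irrefl = λ i → strong-irrefl G₁ G₂ i
  ; sym    = λ i j →
      let (u  , v ) = remQuot {n₁} n₂ i
          (u' , v') = remQuot {n₁} n₂ j
      in cong₂ _∧_ (Eq.cong not (eqb-sym i j))
           (cong₂ _∧_ (cong₂ _∨_ (eqb-sym u u') (sym G₁ u u'))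
                      (cong₂ _∨_ (eqb-sym v v') (sym G₂ v v')))
  }

{-# OPTIONS --safe #-}
module Submission where

-- Work with closed neighbourhoods N[x] = {x} ∪ N(x). In G₁ ⊠ G₂ the closed neighbourhood of
-- (u, v) is N[u] × N[v], so sizes of closed common neighbourhoods multiply. In an edge-regular
-- graph |N[u] ∩ N[u']| is k + 1 if u = u' and λ + 2 if u ~ u', while for adjacent x, y it is
-- always λ(x, y) + 2. Hence λ + 2 must equal (k₁+1)(λ₂+2), (λ₁+2)(k₂+1) or (λ₁+2)(λ₂+2)
-- according as an edge of the product has equal first, equal second, or no equal coordinates;
-- all three kinds of edges occur, and expanding the products gives the stated equations.
-- Similarly every degree is (k₁+1)(k₂+1) − 1.

open import Defs hiding (sym)
open import Data.Bool using (Bool; true; false; _∧_; _∨_; not; if_then_else_)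
open import Data.Bool.Properties
  using (∧-idem; ∧-zeroʳ; ∨-zeroʳ; ∧-conicalˡ; ∧-conicalʳ; ∧-commutativeMonoid)
open import Data.Empty using (⊥-elim)
open import Data.Fin using (Fin; zero; suc; remQuot; combine; _↑ˡ_; _↑ʳ_; _≟_)
open import Data.Fin.Properties
  using (remQuot-combine; combine-remQuot; combine-injectiveˡ; combine-injectiveʳ)
open import Data.List using (tabulate)
open import Data.List.Properties using (map-tabulate)
import Data.Nat.ListAction as List
open import Data.Nat using (ℕ; zero; suc; _+_; _*_)
open import Data.Nat.Properties
  using (+-*-semiring; +-assoc; +-identityʳ; +-cancelˡ-≡; suc-injective; *-comm)
open import Data.Nat.Tactic.RingSolver using (solve-∀)
open import Data.Product using (_×_; _,_; proj₁; proj₂)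
open import Data.Sum using (_⊎_; inj₁; inj₂)
open import Function using (_∘_; id; _⇔_; mk⇔; Equivalence)
open import Relation.Binary.PropositionalEquality
open import Relation.Nullary using (yes; no)

open import Algebra.Bundles using (CommutativeMonoid)
open import Algebra.Properties.CommutativeSemigroup
  (CommutativeMonoid.commutativeSemigroup ∧-commutativeMonoid)
  using () renaming (interchange to ∧-interchange)
open import Algebra.Properties.Semiring.Sum +-*-semiring
  using (sum; sum-syntax; ∑-distrib-+; *-distribˡ-sum; *-distribʳ-sum; sum-cong-≗; sum-replicate-zero)

eqb⇒≡ : ∀ {n} {u w : Fin n} → eqb u w ≡ true → u ≡ w
eqb⇒≡ {u = u} {w} e with u ≟ w
... | yes u≡w = u≡w

≢⇒eqb≡false : ∀ {n} {u w : Fin n} → u ≢ w → eqb u w ≡ false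
≢⇒eqb≡false {u = u} {w} u≢w with u ≟ w
... | yes u≡w = ⊥-elim (u≢w u≡w)
... | no _    = refl

eqb-suc : ∀ {n} (u w : Fin n) → eqb (suc u) (suc w) ≡ eqb u w
eqb-suc u w with u ≟ w
... | yes _ = refl
... | no _  = refl

∨-not-∧ : ∀ {e p} → (e ≡ true → p ≡ true) → e ∨ (not e ∧ p) ≡ p
∨-not-∧ {true}  e⇒p = sym (e⇒p refl)
∨-not-∧ {false} _   = refl

∨-∧-∨ : ∀ {x y a b} → (x ≡ true → b ≡ true) → (y ≡ true → a ≡ true) →
        (x ∨ a) ∧ (y ∨ b) ≡ x ∨ (y ∨ (a ∧ b))
∨-∧-∨ {true}  {y}     x⇒b _   rewrite x⇒b refl = ∨-zeroʳ y
∨-∧-∨ {false} {true}  _   y⇒a rewrite y⇒a refl = refl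
∨-∧-∨ {false} {false} _   _   = refl

indicator : Bool → ℕ
indicator b = if b then 1 else 0

indicator-∧ : ∀ a b → indicator (a ∧ b) ≡ indicator a * indicator b
indicator-∧ true  b = sym (+-identityʳ (indicator b))
indicator-∧ false b = refl

sum-tabulate : ∀ {n} (f : Fin n → ℕ) → List.sum (tabulate f) ≡ sum f
sum-tabulate {zero}  f = refl
sum-tabulate {suc n} f = cong (f zero +_) (sum-tabulate (f ∘ suc))

sum-↑ : ∀ {m n} (f : Fin (m + n) → ℕ) → sum f ≡ sum (f ∘ (_↑ˡ n)) + sum (f ∘ (m ↑ʳ_))
sum-↑ {zero}  f = refl
sum-↑ {suc m} f = trans (cong (f zero +_) (sum-↑ {m} (f ∘ suc))) (sym (+-assoc (f zero) _ _))

sum-combine : ∀ {m n} (f : Fin (m * n) → ℕ) → sum f ≡ ∑[ u < m ] ∑[ v < n ] f (combine u v)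
sum-combine {zero}      f = refl
sum-combine {suc m} {n} f =
  trans (sum-↑ {n} f) (cong (sum (f ∘ (_↑ˡ m * n)) +_) (sum-combine {m} (f ∘ (n ↑ʳ_))))

sum-eqb : ∀ {n} (u : Fin n) → ∑[ w < n ] indicator (eqb u w) ≡ 1
sum-eqb {suc n} zero    = cong suc (sum-replicate-zero n)
sum-eqb {suc n} (suc u) = trans (sum-cong-≗ (cong indicator ∘ eqb-suc u)) (sum-eqb u)

count≡sum : ∀ {n} (p : Fin n → Bool) → count p ≡ ∑[ w < n ] indicator (p w)
count≡sum p = trans (cong List.sum (map-tabulate id (indicator ∘ p))) (sum-tabulate (indicator ∘ p))

count-cong : ∀ {n} {p q : Fin n → Bool} → (∀ w → p w ≡ q w) → count p ≡ count q
count-cong {p = p} {q} p≗q =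
  trans (count≡sum p) (trans (sum-cong-≗ (cong indicator ∘ p≗q)) (sym (count≡sum q)))

count-insert : ∀ {n} {p : Fin n → Bool} (u : Fin n) → p u ≡ false →
               count (λ w → eqb u w ∨ p w) ≡ suc (count p)
count-insert {n} {p} u pu≡false = begin
  count (λ w → eqb u w ∨ p w)                                 ≡⟨ count≡sum (λ w → eqb u w ∨ p w) ⟩
  ∑[ w < n ] indicator (eqb u w ∨ p w)                        ≡⟨ sum-cong-≗ split ⟩
  ∑[ w < n ] (indicator (eqb u w) + indicator (p w))          ≡⟨ ∑-distrib-+ (indicator ∘ eqb u) (indicator ∘ p) ⟩
  ∑[ w < n ] indicator (eqb u w) + ∑[ w < n ] indicator (p w) ≡⟨ cong₂ _+_ (sum-eqb u) (sym (count≡sum p)) ⟩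
  suc (count p)                                               ∎
  where
  open ≡-Reasoning
  split : ∀ w → indicator (eqb u w ∨ p w) ≡ indicator (eqb u w) + indicator (p w)
  split w with eqb u w in e
  ... | false = refl
  ... | true with refl ← eqb⇒≡ e rewrite pu≡false = refl

count-remQuot : ∀ {m n} (p : Fin m → Bool) (q : Fin n → Bool) →
  count (λ i → p (proj₁ (remQuot {m} n i)) ∧ q (proj₂ (remQuot {m} n i))) ≡ count p * count q
count-remQuot {m} {n} p q = begin
  count (λ i → r i)                                              ≡⟨ count≡sum r ⟩
  ∑[ i < m * n ] indicator (r i)                                 ≡⟨ sum-combine {m} (indicator ∘ r) ⟩
  ∑[ u < m ] ∑[ v < n ] indicator (r (combine u v))              ≡⟨ sum-cong-≗ (λ u → sum-cong-≗ (on-combine u)) ⟩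
  ∑[ u < m ] ∑[ v < n ] (indicator (p u) * indicator (q v))      ≡⟨ sum-cong-≗ (λ u → sym (*-distribˡ-sum (indicator (p u)) (indicator ∘ q))) ⟩
  ∑[ u < m ] (indicator (p u) * ∑[ v < n ] indicator (q v))      ≡⟨ sym (*-distribʳ-sum (∑[ v < n ] indicator (q v)) (indicator ∘ p)) ⟩
  ∑[ u < m ] indicator (p u) * ∑[ v < n ] indicator (q v)        ≡⟨ sym (cong₂ _*_ (count≡sum p) (count≡sum q)) ⟩
  count p * count q                                              ∎
  where
  open ≡-Reasoning
  r : Fin (m * n) → Bool
  r i = p (proj₁ (remQuot {m} n i)) ∧ q (proj₂ (remQuot {m} n i))
  on-combine : ∀ u v → indicator (r (combine u v)) ≡ indicator (p u) * indicator (q v)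
  on-combine u v = trans (cong (λ x → indicator (p (proj₁ x) ∧ q (proj₂ x))) (remQuot-combine u v))
                         (indicator-∧ (p u) (q v))

closedAdj : ∀ {n} → Graph n → Fin n → Fin n → Bool
closedAdj G u w = eqb u w ∨ adj G u w

closedCommon : ∀ {n} → Graph n → Fin n → Fin n → ℕ
closedCommon G u v = count (λ w → closedAdj G u w ∧ closedAdj G v w)

module _ {n} (G : Graph n) where

  adj⇒≢ : ∀ {u v} → adj G u v ≡ true → u ≢ v
  adj⇒≢ {u} uv refl with trans (sym (irrefl G u)) uv
  ... | ()

  ≡⇒closedAdj : ∀ {u v} → u ≡ v → closedAdj G u v ≡ true
  ≡⇒closedAdj {u} refl = cong (_∨ adj G u u) (eqb-refl u)

  adj⇒closedAdj : ∀ {u v} → adj G u v ≡ true → closedAdj G u v ≡ true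
  adj⇒closedAdj {u} {v} uv = trans (cong (eqb u v ∨_) uv) (∨-zeroʳ (eqb u v))

  closedAdj⇒≡⊎adj : ∀ {u v} → closedAdj G u v ≡ true → u ≡ v ⊎ adj G u v ≡ true
  closedAdj⇒≡⊎adj {u} {v} c with eqb u v in e
  ... | true  = inj₁ (eqb⇒≡ e)
  ... | false = inj₂ c

  closedCommon-refl : ∀ u → closedCommon G u u ≡ suc (degree G u)
  closedCommon-refl u =
    trans (count-cong (λ w → ∧-idem (closedAdj G u w))) (count-insert u (irrefl G u))

  closedCommon-adj : ∀ {u v} → adj G u v ≡ true → closedCommon G u v ≡ 2 + commonNeighbours G u v
  closedCommon-adj {u} {v} uv = begin
    closedCommon G u v                            ≡⟨ count-cong (λ w → ∨-∧-∨ (at-u w) (at-v w)) ⟩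
    count (λ w → eqb u w ∨ (eqb v w ∨ common w))  ≡⟨ count-insert u u∉ ⟩
    suc (count (λ w → eqb v w ∨ common w))        ≡⟨ cong suc (count-insert v v∉) ⟩
    2 + commonNeighbours G u v                    ∎
    where
    open ≡-Reasoning
    common : Fin n → Bool
    common w = adj G u w ∧ adj G v w
    at-u : ∀ w → eqb u w ≡ true → adj G v w ≡ true
    at-u w e with refl ← eqb⇒≡ e = trans (Graph.sym G v u) uv
    at-v : ∀ w → eqb v w ≡ true → adj G u w ≡ true
    at-v w e with refl ← eqb⇒≡ e = uv
    u∉ : eqb v u ∨ common u ≡ false
    u∉ = cong₂ _∨_ (≢⇒eqb≡false (adj⇒≢ uv ∘ sym)) (cong (_∧ adj G v u) (irrefl G u))
    v∉ : common v ≡ false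
    v∉ = trans (cong (adj G u v ∧_) (irrefl G v)) (∧-zeroʳ (adj G u v))

  module _ {k l} (regular : EdgeRegular G k l) where

    closedCommon-≡ : ∀ {u v} → u ≡ v → closedCommon G u v ≡ suc k
    closedCommon-≡ {u} refl = trans (closedCommon-refl u) (cong suc (proj₁ regular u))

    closedCommon-edge : ∀ {u v} → adj G u v ≡ true → closedCommon G u v ≡ 2 + l
    closedCommon-edge {u} {v} uv = trans (closedCommon-adj uv) (cong (2 +_) (proj₂ regular u v uv))

ClosedCommonSizes : (k₁ k₂ l₁ l₂ l : ℕ) → Set
ClosedCommonSizes k₁ k₂ l₁ l₂ l =
  (suc k₁ * (2 + l₂) ≡ 2 + l) × ((2 + l₁) * suc k₂ ≡ 2 + l) × ((2 + l₁) * (2 + l₂) ≡ 2 + l)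

closedCommonSizes⇔ : ∀ k₁ k₂ l₁ l₂ l → ClosedCommonSizes k₁ k₂ l₁ l₂ l ⇔
  ((l₂ + k₁ * l₂ + 2 * k₁ ≡ l₁ + k₂ * l₁ + 2 * k₂) ×
   (l₁ + k₂ * l₁ + 2 * k₂ ≡ l₁ * l₂ + 2 * l₂ + 2 * l₁ + 2) ×
   (l₁ * l₂ + 2 * l₂ + 2 * l₁ + 2 ≡ l))
closedCommonSizes⇔ k₁ k₂ l₁ l₂ l = mk⇔
  (λ (s₁ , s₂ , s₃) → let a≡l = cancel expand₁ s₁; b≡l = cancel expand₂ s₂; d≡l = cancel expand₃ s₃
                      in trans a≡l (sym b≡l) , trans b≡l (sym d≡l) , d≡l)
  (λ (a≡b , b≡d , d≡l) → trans expand₁ (cong (2 +_) (trans a≡b (trans b≡d d≡l)))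
                       , trans expand₂ (cong (2 +_) (trans b≡d d≡l))
                       , trans expand₃ (cong (2 +_) d≡l))
  where
  suc-*-2+ : ∀ k m → suc k * (2 + m) ≡ 2 + (m + k * m + 2 * k)
  suc-*-2+ = solve-∀
  2+-*-2+ : ∀ m m' → (2 + m) * (2 + m') ≡ 2 + (m * m' + 2 * m' + 2 * m + 2)
  2+-*-2+ = solve-∀
  expand₁ : suc k₁ * (2 + l₂) ≡ 2 + (l₂ + k₁ * l₂ + 2 * k₁)
  expand₁ = suc-*-2+ k₁ l₂
  expand₂ : (2 + l₁) * suc k₂ ≡ 2 + (l₁ + k₂ * l₁ + 2 * k₂)
  expand₂ = trans (*-comm (2 + l₁) (suc k₂)) (suc-*-2+ k₂ l₁)
  expand₃ : (2 + l₁) * (2 + l₂) ≡ 2 + (l₁ * l₂ + 2 * l₂ + 2 * l₁ + 2)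
  expand₃ = 2+-*-2+ l₁ l₂
  cancel : ∀ {p x} → p ≡ 2 + x → p ≡ 2 + l → x ≡ l
  cancel e s = +-cancelˡ-≡ 2 _ _ (trans (sym e) s)

module _ {n₁ n₂} (G₁ : Graph n₁) (G₂ : Graph n₂) where

  private
    H : Graph (n₁ * n₂)
    H = strongProduct G₁ G₂

    π₁ : Fin (n₁ * n₂) → Fin n₁
    π₁ i = proj₁ (remQuot {n₁} n₂ i)

    π₂ : Fin (n₁ * n₂) → Fin n₂
    π₂ i = proj₂ (remQuot {n₁} n₂ i)

  closedAdj-strongProduct : ∀ i j →
    closedAdj H i j ≡ closedAdj G₁ (π₁ i) (π₁ j) ∧ closedAdj G₂ (π₂ i) (π₂ j)
  closedAdj-strongProduct i j = ∨-not-∧ λ e →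
    cong₂ _∧_ (≡⇒closedAdj G₁ (cong π₁ (eqb⇒≡ e))) (≡⇒closedAdj G₂ (cong π₂ (eqb⇒≡ e)))

  closedCommon-strongProduct : ∀ i j →
    closedCommon H i j ≡ closedCommon G₁ (π₁ i) (π₁ j) * closedCommon G₂ (π₂ i) (π₂ j)
  closedCommon-strongProduct i j =
    trans (count-cong λ w → trans (cong₂ _∧_ (closedAdj-strongProduct i w) (closedAdj-strongProduct j w))
                                  (∧-interchange (closedAdj G₁ (π₁ i) (π₁ w)) (closedAdj G₂ (π₂ i) (π₂ w))
                                                 (closedAdj G₁ (π₁ j) (π₁ w)) (closedAdj G₂ (π₂ j) (π₂ w))))
          (count-remQuot (λ x → closedAdj G₁ (π₁ i) x ∧ closedAdj G₁ (π₁ j) x)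
                         (λ y → closedAdj G₂ (π₂ i) y ∧ closedAdj G₂ (π₂ j) y))

  degree-strongProduct : ∀ i → suc (degree H i) ≡ suc (degree G₁ (π₁ i)) * suc (degree G₂ (π₂ i))
  degree-strongProduct i = begin
    suc (degree H i)                                        ≡⟨ closedCommon-refl H i ⟨
    closedCommon H i i                                      ≡⟨ closedCommon-strongProduct i i ⟩
    closedCommon G₁ (π₁ i) (π₁ i) * closedCommon G₂ (π₂ i) (π₂ i)
      ≡⟨ cong₂ _*_ (closedCommon-refl G₁ (π₁ i)) (closedCommon-refl G₂ (π₂ i)) ⟩
    suc (degree G₁ (π₁ i)) * suc (degree G₂ (π₂ i))         ∎
    where open ≡-Reasoning

  commonNeighbours-strongProduct : ∀ {i j} → adj H i j ≡ true →
    2 + commonNeighbours H i j ≡ closedCommon G₁ (π₁ i) (π₁ j) * closedCommon G₂ (π₂ i) (π₂ j)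
  commonNeighbours-strongProduct {i} {j} ij = trans (sym (closedCommon-adj H {i} {j} ij)) (closedCommon-strongProduct i j)

  adj-strongProduct⇒ : ∀ {i j} → adj H i j ≡ true →
    i ≢ j × closedAdj G₁ (π₁ i) (π₁ j) ≡ true × closedAdj G₂ (π₂ i) (π₂ j) ≡ true
  adj-strongProduct⇒ {i} {j} ij = adj⇒≢ H ij , ∧-conicalˡ c₁ c₂ c₁∧c₂ , ∧-conicalʳ c₁ c₂ c₁∧c₂
    where
    c₁ c₂ : Bool
    c₁ = closedAdj G₁ (π₁ i) (π₁ j)
    c₂ = closedAdj G₂ (π₂ i) (π₂ j)
    c₁∧c₂ : c₁ ∧ c₂ ≡ true
    c₁∧c₂ = ∧-conicalʳ (not (eqb i j)) (c₁ ∧ c₂) ij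

  π-injective : ∀ {i j} → π₁ i ≡ π₁ j → π₂ i ≡ π₂ j → i ≡ j
  π-injective {i} {j} e₁ e₂ =
    trans (sym (combine-remQuot {n₁} n₂ i)) (trans (cong₂ combine e₁ e₂) (combine-remQuot {n₁} n₂ j))

  adj-strongProduct⇐ : ∀ {i j} → i ≢ j →
    closedAdj G₁ (π₁ i) (π₁ j) ≡ true → closedAdj G₂ (π₂ i) (π₂ j) ≡ true → adj H i j ≡ true
  adj-strongProduct⇐ i≢j c₁ c₂ = cong₂ (λ e c → not e ∧ c) (≢⇒eqb≡false i≢j) (cong₂ _∧_ c₁ c₂)

  π₁-combine : ∀ u v → π₁ (combine u v) ≡ u
  π₁-combine u v = cong proj₁ (remQuot-combine {n₁} {n₂} u v)

  π₂-combine : ∀ u v → π₂ (combine u v) ≡ v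
  π₂-combine u v = cong proj₂ (remQuot-combine {n₁} {n₂} u v)

  closedCommon-combine : ∀ {k l u u' v v'} → EdgeRegular H k l → combine u v ≢ combine u' v' →
    closedAdj G₁ u u' ≡ true → closedAdj G₂ v v' ≡ true →
    closedCommon G₁ u u' * closedCommon G₂ v v' ≡ 2 + l
  closedCommon-combine {u = u} {u'} {v} {v'} regular i≢j c₁ c₂ = begin
    closedCommon G₁ u u' * closedCommon G₂ v v'
      ≡⟨ cong₂ _*_ (cong₂ (closedCommon G₁) (π₁-combine u v) (π₁-combine u' v'))
                   (cong₂ (closedCommon G₂) (π₂-combine u v) (π₂-combine u' v')) ⟨
    closedCommon G₁ (π₁ i) (π₁ j) * closedCommon G₂ (π₂ i) (π₂ j)
      ≡⟨ commonNeighbours-strongProduct {i} {j} ij ⟨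
    2 + commonNeighbours H i j
      ≡⟨ cong (2 +_) (proj₂ regular i j ij) ⟩
    2 + _ ∎
    where
    open ≡-Reasoning
    i j : Fin (n₁ * n₂)
    i = combine u v
    j = combine u' v'
    ij : adj H i j ≡ true
    ij = adj-strongProduct⇐ i≢j
      (trans (cong₂ (closedAdj G₁) (π₁-combine u v) (π₁-combine u' v')) c₁)
      (trans (cong₂ (closedAdj G₂) (π₂-combine u v) (π₂-combine u' v')) c₂)

  module _ {k₁ k₂ l₁ l₂} (regular₁ : EdgeRegular G₁ k₁ l₁) (regular₂ : EdgeRegular G₂ k₂ l₂) where

    edgeRegular-strongProduct⇒ : ∀ {l} → HasEdge G₁ → HasEdge G₂ →
      EdgeRegular H (k₁ + k₂ + k₁ * k₂) l → ClosedCommonSizes k₁ k₂ l₁ l₂ l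
    edgeRegular-strongProduct⇒ {l} (u , u' , uu') (v , v' , vv') regular =
        size u u v v' (adj⇒≢ G₂ vv' ∘ combine-injectiveʳ u v u v')
             (≡⇒closedAdj G₁ refl) (closedCommon-≡ G₁ regular₁ {u} refl)
             (adj⇒closedAdj G₂ vv') (closedCommon-edge G₂ regular₂ vv')
      , size u u' v v (adj⇒≢ G₁ uu' ∘ combine-injectiveˡ u v u' v)
             (adj⇒closedAdj G₁ uu') (closedCommon-edge G₁ regular₁ uu')
             (≡⇒closedAdj G₂ refl) (closedCommon-≡ G₂ regular₂ {v} refl)
      , size u u' v v' (adj⇒≢ G₁ uu' ∘ combine-injectiveˡ u v u' v')
             (adj⇒closedAdj G₁ uu') (closedCommon-edge G₁ regular₁ uu')
             (adj⇒closedAdj G₂ vv') (closedCommon-edge G₂ regular₂ vv')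
      where
      size : ∀ x x' y y' {s t} → combine x y ≢ combine x' y' →
             closedAdj G₁ x x' ≡ true → closedCommon G₁ x x' ≡ s →
             closedAdj G₂ y y' ≡ true → closedCommon G₂ y y' ≡ t → s * t ≡ 2 + l
      size _ _ _ _ ne c₁ s₁ c₂ s₂ = trans (sym (cong₂ _*_ s₁ s₂)) (closedCommon-combine regular ne c₁ c₂)

    edgeRegular-strongProduct⇐ : ∀ {l} → ClosedCommonSizes k₁ k₂ l₁ l₂ l →
      EdgeRegular H (k₁ + k₂ + k₁ * k₂) l
    edgeRegular-strongProduct⇐ {l} (s₁ , s₂ , s₃) = degree≡ , commonNeighbours≡
      where
      degree≡ : ∀ i → degree H i ≡ k₁ + k₂ + k₁ * k₂
      degree≡ i = suc-injective (begin
        suc (degree H i)                                 ≡⟨ degree-strongProduct i ⟩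
        suc (degree G₁ (π₁ i)) * suc (degree G₂ (π₂ i))  ≡⟨ cong₂ (λ d₁ d₂ → suc d₁ * suc d₂) (proj₁ regular₁ (π₁ i)) (proj₁ regular₂ (π₂ i)) ⟩
        suc k₁ * suc k₂                                  ≡⟨ suc-*-suc k₁ k₂ ⟩
        suc (k₁ + k₂ + k₁ * k₂)                          ∎)
        where
        open ≡-Reasoning
        suc-*-suc : ∀ a b → suc a * suc b ≡ suc (a + b + a * b)
        suc-*-suc = solve-∀

      commonNeighbours≡ : ∀ i j → adj H i j ≡ true → commonNeighbours H i j ≡ l
      commonNeighbours≡ i j ij with adj-strongProduct⇒ ij
      ... | i≢j , c₁ , c₂ = +-cancelˡ-≡ 2 _ _
        (trans (commonNeighbours-strongProduct ij) (size (closedAdj⇒≡⊎adj G₁ c₁) (closedAdj⇒≡⊎adj G₂ c₂)))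
        where
        u u' : Fin n₁
        u = π₁ i
        u' = π₁ j
        v v' : Fin n₂
        v = π₂ i
        v' = π₂ j
        size : u ≡ u' ⊎ adj G₁ u u' ≡ true → v ≡ v' ⊎ adj G₂ v v' ≡ true →
               closedCommon G₁ u u' * closedCommon G₂ v v' ≡ 2 + l
        size (inj₁ u≡u') (inj₁ v≡v') = ⊥-elim (i≢j (π-injective u≡u' v≡v'))
        size (inj₁ u≡u') (inj₂ vv')  =
          trans (cong₂ _*_ (closedCommon-≡ G₁ regular₁ u≡u') (closedCommon-edge G₂ regular₂ vv')) s₁
        size (inj₂ uu')  (inj₁ v≡v') =
          trans (cong₂ _*_ (closedCommon-edge G₁ regular₁ uu') (closedCommon-≡ G₂ regular₂ v≡v')) s₂
        size (inj₂ uu')  (inj₂ vv')  =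
          trans (cong₂ _*_ (closedCommon-edge G₁ regular₁ uu') (closedCommon-edge G₂ regular₂ vv')) s₃

mainTheorem5 : {n₁ n₂ k₁ k₂ l₁ l₂ : ℕ} (G₁ : Graph n₁) (G₂ : Graph n₂) →
    HasEdge G₁ → HasEdge G₂ →
    EdgeRegular G₁ k₁ l₁ → EdgeRegular G₂ k₂ l₂ → (l : ℕ) →
    EdgeRegular (strongProduct G₁ G₂) (k₁ + k₂ + k₁ * k₂) l
      ⇔ ((l₂ + k₁ * l₂ + 2 * k₁ ≡ l₁ + k₂ * l₁ + 2 * k₂) ×
         (l₁ + k₂ * l₁ + 2 * k₂ ≡ l₁ * l₂ + 2 * l₂ + 2 * l₁ + 2) ×
         (l₁ * l₂ + 2 * l₂ + 2 * l₁ + 2 ≡ l))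
mainTheorem5 {k₁ = k₁} {k₂} {l₁} {l₂} G₁ G₂ edge₁ edge₂ regular₁ regular₂ l = mk⇔
  (to ∘ edgeRegular-strongProduct⇒ G₁ G₂ regular₁ regular₂ edge₁ edge₂)
  (edgeRegular-strongProduct⇐ G₁ G₂ regular₁ regular₂ ∘ from)
  where open Equivalence (closedCommonSizes⇔ k₁ k₂ l₁ l₂ l)
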